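{- Let $\lambda=(\lambda_1^{\beta})$ and $\mu=(\mu_1^{\alpha})$ be rectangular partitions fitting in the $k\times(n-k)$ box, and let $T$ be a Buch tableau for $(\lambda,\mu)$ in the $k\times(n-k)$ box. Then for every column of the $\mu$-part of $T$, listing the entries of its boxes from top to bottom (entries within a box in increasing order) gives a sequence of the form $$1,2,\dots,p,\ \beta+1,\beta+2,\dots,q$$ for some $0\le p\le\alpha$ and $\beta\le q\le\beta+\alpha$ (either block possibly empty), where at most one overlap between the two blocks occurs, i.e. at most one box of the column contains more than one entry, and such a box contains exactly $\{p,\beta+1\}$.
   Context: $(\lambda_1^\beta)$ denotes the rectangle with $\beta$ rows of length $\lambda_1$. For finite nonempty $a,b\subset\mathbb{Z}_{>0}$, $a\le b$ means $\max a\le\min b$ and $a<b$ means $\max a<\min b$. A set-valued tableau is a filling of the boxes of a (skew) diagram by finite nonempty subsets of $\mathbb{Z}_{>0}$; semistandard means weakly increasing ($\le$) along rows and strictly increasing ($<$) down columns. The skew shape $\lambda\times\mu$ places the diagram of $\mu$ directly southwest of that of $\lambda$ ($\lambda$ in rows $1,\dots,\ell(\lambda)$, columns $\mu_1+1,\dots,\mu_1+\lambda_1$; $\mu$ in the following $\ell(\mu)$ rows, columns $1,\dots,\mu_1$); the "$\mu$-part" of a tableau of this shape is its restriction to the boxes of $\mu$. The word of $T$ reads rows top to bottom, each right to left, elements of a box in decreasing order; it is a reverse lattice word if every initial segment has, for each $i\ge1$, at least as many $i$'s as $(i+1)$'s. The content of $T$ is $(c_1,c_2,\dots)$, $c_i$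 = number of occurrences of $i$. A Buch tableau for $(\lambda,\mu)$ in the $k\times(n-k)$ box is a semistandard set-valued tableau of shape $\lambda\times\mu$ with reverse lattice word and content fitting in the $k\times(n-k)$ box (at most $k$ parts, each at most $n-k$). -}

module Defs where

open import Data.Nat using (ℕ; zero; suc; _+_; _∸_; _≤_; _<_; _≟_)
open import Relation.Nullary using (yes; no)
open import Data.List using (List; []; _∷_; _++_; concat; map; reverse; applyUpTo; take; length)
open import Data.List.Relation.Unary.All using (All)
open import Data.List.Relation.Unary.Linked using (Linked)
open import Data.Product using (_×_)
open import Relation.Binary.PropositionalEquality using (_≡_)

ints : ℕ → ℕ → List ℕ
ints a m = applyUpTo (λ i → a + i) m

-- A finite nonempty subset of ℤ_{>0} is represented canonically as a
-- strictly increasing nonempty list of positive naturals.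
ValidSet : List ℕ → Set
ValidSet xs = (1 ≤ length xs) × Linked _<_ xs × All (λ x → 1 ≤ x) xs

_≤ˢ_ : List ℕ → List ℕ → Set
a ≤ˢ b = All (λ x → All (λ y → x ≤ y) b) a

_<ˢ_ : List ℕ → List ℕ → Set
a <ˢ b = All (λ x → All (λ y → x < y) b) a

-- A filling of the plane: T r c is the set in row r, column c (1-indexed).
Filling : Set
Filling = ℕ → ℕ → List ℕ

InLam : (l1 β m1 α : ℕ) → ℕ → ℕ → Set
InLam l1 β m1 α r c = (1 ≤ r) × (r ≤ β) × (m1 < c) × (c ≤ m1 + l1)

InMu : (l1 β m1 α : ℕ) → ℕ → ℕ → Set
InMu l1 β m1 α r c = (β < r) × (r ≤ β + α) × (1 ≤ c) × (c ≤ m1)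

data InShape (l1 β m1 α : ℕ) (r c : ℕ) : Set where
  inLam : InLam l1 β m1 α r c → InShape l1 β m1 α r c
  inMu  : InMu  l1 β m1 α r c → InShape l1 β m1 α r c

record SemistandardSV (l1 β m1 α : ℕ) (T : Filling) : Set where
  field
    boxes : ∀ r c → InShape l1 β m1 α r c → ValidSet (T r c)
    rows  : ∀ r c → InShape l1 β m1 α r c → InShape l1 β m1 α r (suc c) →
            T r c ≤ˢ T r (suc c)
    cols  : ∀ r c → InShape l1 β m1 α r c → InShape l1 β m1 α (suc r) c →
            T r c <ˢ T (suc r) c

-- Reading word: rows top to bottom, each row right to left, elements of
-- a box in decreasing order (boxes are stored increasing, hence reverse).
rowWord : Filling → ℕ → List ℕ → List ℕ
rowWord T r cs = concat (map (λ c → reverse (T r c)) (reverse cs))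

word : (l1 β m1 α : ℕ) → Filling → List ℕ
word l1 β m1 α T =
  concat (map (λ r → rowWord T r (ints (suc m1) l1)) (ints 1 β)) ++
  concat (map (λ r → rowWord T r (ints 1 m1)) (ints (suc β) α))

occ : ℕ → List ℕ → ℕ
occ i [] = 0
occ i (x ∷ w) with x ≟ i
... | yes _ = suc (occ i w)
... | no _ = occ i w

ReverseLattice : List ℕ → Set
ReverseLattice w = ∀ m i → occ (suc (suc i)) (take m w) ≤ occ (suc i) (take m w)

ContentFits : ℕ → ℕ → List ℕ → Set
ContentFits n k w = (∀ i → k < i → occ i w ≡ 0) × (∀ i → occ i w ≤ n ∸ k)

record Buch (n k l1 β m1 α : ℕ) (T : Filling) : Set where
  field
    semistandard : SemistandardSV l1 β m1 α T
    lattice      : ReverseLattice (word l1 β m1 α T)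
    fits         : ContentFits n k (word l1 β m1 α T)

RectFits : ℕ → ℕ → ℕ → ℕ → Set
RectFits n k a b = (b ≤ k) × (a ≤ n ∸ k)

muColumn : (β α : ℕ) → Filling → ℕ → List ℕ
muColumn β α T c = concat (map (λ r → T r c) (ints (suc β) α))

module Submission where

-- A *rectangle block* is a set of consecutive rows r₀+1, …, r₀+h
-- and columns c₀+1, …, c₀+w of a semistandard set-valued tableau whose word
-- is read right after a word W containing each of 1, …, B exactly L times and
-- no letter above B, the whole word being reverse lattice.  By induction on
-- the number j of rows, every column of the first j rows reads
--   1, 2, …, p, B+1, B+2, …, B+u        (p ≤ B, p ≤ j, u ≤ j ≤ p + u)
-- with at most one box holding two entries, necessarily {p, B+1}
-- (module RectangleBlock).  In the inductive step the boxes of row j+1 are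
-- treated from right to left; each entry z is bounded below by column
-- strictness and above by the lattice condition on the prefix ending at z.
-- The theorem applies this twice (module TwoRectangles): to the λ-part with
-- B = 0, showing that every λ-column reads 1, …, β, hence the λ-word has each
-- of 1, …, β exactly λ₁ times; then to the μ-part with B = β.

open import Defs
open import Data.Nat using (ℕ; zero; suc; _+_; _∸_; _≤_; _<_; _≟_; _≤?_; _<?_; z≤n; s≤s; z<s)
open import Data.Nat.Properties
open import Data.Nat.Tactic.RingSolver using (solve-∀)
open import Data.List using (List; []; _∷_; _++_; concat; map; reverse; applyUpTo; take; length; [_])
open import Data.List.Properties using (++-assoc; ++-identityʳ; reverse-++; applyUpTo-∷ʳ; unfold-reverse)
open import Data.List.Relation.Unary.All using (All; []; _∷_) renaming (map to All-map)
open import Data.List.Relation.Unary.All.Properties using (++⁻ˡ; ++⁻ʳ; concat⁺; map⁺)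
open import Data.List.Relation.Unary.Linked using (Linked; []; _∷_)
open import Data.List.Relation.Unary.Linked.Properties using (Linked⇒All)
open import Data.Product using (Σ; _×_; _,_; proj₁; proj₂; ∃₂)
open import Data.Sum using (_⊎_; inj₁; inj₂)
open import Data.Empty using (⊥; ⊥-elim)
open import Relation.Nullary using (yes; no)
open import Relation.Binary.Definitions using (tri<; tri≈; tri>)
open import Relation.Binary.PropositionalEquality hiding ([_])

occ-here : ∀ x l → occ x (x ∷ l) ≡ suc (occ x l)
occ-here x l with x ≟ x
... | yes _ = refl
... | no x≢x = ⊥-elim (x≢x refl)

occ-there : ∀ {x y} l → y ≢ x → occ x (y ∷ l) ≡ occ x l
occ-there {x} {y} l y≢x with y ≟ x
... | yes y≡x = ⊥-elim (y≢x y≡x)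
... | no _ = refl

occ-singleton : ∀ x → occ x [ x ] ≡ 1
occ-singleton x = occ-here x []

occ-++ : ∀ x a b → occ x (a ++ b) ≡ occ x a + occ x b
occ-++ x [] b = refl
occ-++ x (y ∷ a) b with y ≟ x
... | yes _ = cong suc (occ-++ x a b)
... | no _ = occ-++ x a b

occ-reverse : ∀ x a → occ x (reverse a) ≡ occ x a
occ-reverse x [] = refl
occ-reverse x (y ∷ a) = begin
  occ x (reverse (y ∷ a))         ≡⟨ cong (occ x) (unfold-reverse y a) ⟩
  occ x (reverse a ++ [ y ])      ≡⟨ occ-++ x (reverse a) [ y ] ⟩
  occ x (reverse a) + occ x [ y ] ≡⟨ cong (_+ occ x [ y ]) (occ-reverse x a) ⟩
  occ x a + occ x [ y ]           ≡⟨ +-comm (occ x a) _ ⟩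
  occ x [ y ] + occ x a           ≡⟨ sym (occ-++ x [ y ] a) ⟩
  occ x (y ∷ a)                   ∎
  where open ≡-Reasoning

occ-absent : ∀ x l → All (_≢ x) l → occ x l ≡ 0
occ-absent x [] [] = refl
occ-absent x (y ∷ l) (y≢x ∷ rest) = trans (occ-there l y≢x) (occ-absent x l rest)

sumOver : List ℕ → (ℕ → ℕ) → ℕ
sumOver [] f = 0
sumOver (x ∷ l) f = f x + sumOver l f

sumOver-++ : ∀ a b f → sumOver (a ++ b) f ≡ sumOver a f + sumOver b f
sumOver-++ [] b f = refl
sumOver-++ (x ∷ a) b f = trans (cong (f x +_) (sumOver-++ a b f)) (sym (+-assoc (f x) _ _))

sumOver-reverse : ∀ l f → sumOver (reverse l) f ≡ sumOver l f
sumOver-reverse [] f = refl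
sumOver-reverse (x ∷ l) f = begin
  sumOver (reverse (x ∷ l)) f          ≡⟨ cong (λ z → sumOver z f) (unfold-reverse x l) ⟩
  sumOver (reverse l ++ [ x ]) f       ≡⟨ sumOver-++ (reverse l) [ x ] f ⟩
  sumOver (reverse l) f + (f x + 0)    ≡⟨ cong₂ _+_ (sumOver-reverse l f) (+-identityʳ (f x)) ⟩
  sumOver l f + f x                    ≡⟨ +-comm (sumOver l f) (f x) ⟩
  f x + sumOver l f                    ∎
  where open ≡-Reasoning

sumOver-cong : ∀ l {f g} → (∀ e → f e ≡ g e) → sumOver l f ≡ sumOver l g
sumOver-cong [] eq = refl
sumOver-cong (x ∷ l) eq = cong₂ _+_ (eq x) (sumOver-cong l eq)

sumOver-+ : ∀ l f g → sumOver l f + sumOver l g ≡ sumOver l (λ e → f e + g e)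
sumOver-+ [] f g = refl
sumOver-+ (x ∷ l) f g = begin
  (f x + sumOver l f) + (g x + sumOver l g) ≡⟨ +-assoc (f x) _ _ ⟩
  f x + (sumOver l f + (g x + sumOver l g)) ≡⟨ cong (f x +_) (sym (+-assoc (sumOver l f) _ _)) ⟩
  f x + ((sumOver l f + g x) + sumOver l g) ≡⟨ cong (λ z → f x + (z + sumOver l g)) (+-comm (sumOver l f) (g x)) ⟩
  f x + ((g x + sumOver l f) + sumOver l g) ≡⟨ cong (f x +_) (+-assoc (g x) _ _) ⟩
  f x + (g x + (sumOver l f + sumOver l g)) ≡⟨ sym (+-assoc (f x) _ _) ⟩
  (f x + g x) + (sumOver l f + sumOver l g) ≡⟨ cong ((f x + g x) +_) (sumOver-+ l f g) ⟩
  (f x + g x) + sumOver l (λ e → f e + g e) ∎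
  where open ≡-Reasoning

sumOver-const0 : ∀ l → sumOver l (λ _ → 0) ≡ 0
sumOver-const0 [] = refl
sumOver-const0 (x ∷ l) = sumOver-const0 l

sumOver-swap : ∀ rs cs (g : ℕ → ℕ → ℕ) →
  sumOver rs (λ r → sumOver cs (g r)) ≡ sumOver cs (λ c → sumOver rs (λ r → g r c))
sumOver-swap [] cs g = sym (sumOver-const0 cs)
sumOver-swap (r ∷ rs) cs g =
  trans (cong (sumOver cs (g r) +_) (sumOver-swap rs cs g))
        (sumOver-+ cs (g r) (λ c → sumOver rs (λ r' → g r' c)))

occ-concat-map : ∀ x (g : ℕ → List ℕ) l → occ x (concat (map g l)) ≡ sumOver l (λ e → occ x (g e))
occ-concat-map x g [] = refl
occ-concat-map x g (e ∷ l) = trans (occ-++ x (g e) _) (cong (occ x (g e) +_) (occ-concat-map x g l))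

applyUpTo-cong : ∀ {f g : ℕ → ℕ} m → (∀ i → f i ≡ g i) → applyUpTo f m ≡ applyUpTo g m
applyUpTo-cong zero eq = refl
applyUpTo-cong (suc m) eq = cong₂ _∷_ (eq 0) (applyUpTo-cong m (λ i → eq (suc i)))

ints-suc : ∀ a m → ints a (suc m) ≡ a ∷ ints (suc a) m
ints-suc a m = cong₂ _∷_ (+-identityʳ a) (applyUpTo-cong m (λ i → +-suc a i))

ints-snoc : ∀ a m → ints a (suc m) ≡ ints a m ++ [ a + m ]
ints-snoc a m = sym (applyUpTo-∷ʳ (λ i → a + i) m)

ints-+ : ∀ a m n → ints a (m + n) ≡ ints a m ++ ints (a + m) n
ints-+ a zero n = cong (λ z → ints z n) (sym (+-identityʳ a))
ints-+ a (suc m) n = begin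
  ints a (suc (m + n))                        ≡⟨ ints-suc a (m + n) ⟩
  a ∷ ints (suc a) (m + n)                    ≡⟨ cong (a ∷_) (ints-+ (suc a) m n) ⟩
  a ∷ (ints (suc a) m ++ ints (suc a + m) n)  ≡⟨ cong (λ z → a ∷ (ints (suc a) m ++ ints z n)) (sym (+-suc a m)) ⟩
  (a ∷ ints (suc a) m) ++ ints (a + suc m) n  ≡⟨ cong (_++ ints (a + suc m) n) (sym (ints-suc a m)) ⟩
  ints a (suc m) ++ ints (a + suc m) n        ∎
  where open ≡-Reasoning

ints-snoc₂ : ∀ j b → ints 1 j ++ (suc j ∷ b ∷ []) ≡ ints 1 (suc j) ++ [ b ]
ints-snoc₂ j b = begin
  ints 1 j ++ ([ suc j ] ++ [ b ])   ≡⟨ sym (++-assoc (ints 1 j) [ suc j ] [ b ]) ⟩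
  (ints 1 j ++ [ suc j ]) ++ [ b ]   ≡⟨ cong (_++ [ b ]) (sym (ints-snoc 1 j)) ⟩
  ints 1 (suc j) ++ [ b ]            ∎
  where open ≡-Reasoning

ints-around : ∀ a d k → ints a (d + suc k) ≡ ints a d ++ (a + d) ∷ ints (suc (a + d)) k
ints-around a d k = trans (ints-+ a d (suc k)) (cong (ints a d ++_) (ints-suc (a + d) k))

restrict-tail : ∀ {P : ℕ → Set} a m → (∀ e → a ≤ e → e < a + suc m → P e) →
                ∀ e → suc a ≤ e → e < suc a + m → P e
restrict-tail a m h e a<e e<end = h e (<⇒≤ a<e) (≤-trans e<end (≤-reflexive (sym (+-suc a m))))

occ-ints-outside : ∀ v a m → v < a ⊎ a + m ≤ v → occ v (ints a m) ≡ 0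
occ-ints-outside v a zero _ = refl
occ-ints-outside v a (suc m) (inj₁ v<a) = trans (cong (occ v) (ints-suc a m))
  (trans (occ-there (ints (suc a) m) (λ a≡v → <-irrefl (sym a≡v) v<a))
         (occ-ints-outside v (suc a) m (inj₁ (m<n⇒m<1+n v<a))))
occ-ints-outside v a (suc m) (inj₂ end≤v) = trans (cong (occ v) (ints-suc a m))
  (trans (occ-there (ints (suc a) m) (λ a≡v → <⇒≱ (m<m+n a z<s) (subst (a + suc m ≤_) (sym a≡v) end≤v)))
         (occ-ints-outside v (suc a) m (inj₂ (≤-trans (≤-reflexive (sym (+-suc a m))) end≤v))))

occ-ints-inside : ∀ v a m → a ≤ v → v < a + m → occ v (ints a m) ≡ 1
occ-ints-inside v a zero a≤v v<a = ⊥-elim (<⇒≱ v<a (≤-trans (≤-reflexive (+-identityʳ a)) a≤v))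
occ-ints-inside v a (suc m) a≤v v<end with a ≟ v
... | yes refl = trans (cong (occ a) (ints-suc a m))
      (trans (occ-here a (ints (suc a) m)) (cong suc (occ-ints-outside a (suc a) m (inj₁ ≤-refl))))
... | no a≢v = trans (cong (occ v) (ints-suc a m)) (trans (occ-there (ints (suc a) m) a≢v)
      (occ-ints-inside v (suc a) m (≤∧≢⇒< a≤v a≢v) (≤-trans v<end (≤-reflexive (+-suc a m)))))

occ-ints-≤1 : ∀ v a m → occ v (ints a m) ≤ 1
occ-ints-≤1 v a m with a ≤? v | v <? a + m
... | yes a≤v | yes v<end = ≤-reflexive (occ-ints-inside v a m a≤v v<end)
... | no a≰v | _ = subst (_≤ 1) (sym (occ-ints-outside v a m (inj₁ (≰⇒> a≰v)))) z≤n
... | yes _ | no v≮end = subst (_≤ 1) (sym (occ-ints-outside v a m (inj₂ (≮⇒≥ v≮end)))) z≤n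

All-ints : ∀ {P : ℕ → Set} a m → (∀ e → a ≤ e → e < a + m → P e) → All P (ints a m)
All-ints a zero h = []
All-ints {P} a (suc m) h = subst (All P) (sym (ints-suc a m))
  (h a ≤-refl (m<m+n a z<s) ∷ All-ints (suc a) m (restrict-tail a m h))

All-ints-at : ∀ {P : ℕ → Set} a m t → All P (ints a m) → t < m → P (a + t)
All-ints-at a zero t _ ()
All-ints-at {P} a (suc m) t h t<m with subst (All P) (ints-suc a m) h
All-ints-at {P} a (suc m) zero h _ | pa ∷ _ = subst P (sym (+-identityʳ a)) pa
All-ints-at {P} a (suc m) (suc t) h (s≤s t<m) | _ ∷ rest = subst P (sym (+-suc a t)) (All-ints-at (suc a) m t rest t<m)

sumOver-ints-mono : ∀ a m (f g : ℕ → ℕ) → (∀ e → a ≤ e → e < a + m → f e ≤ g e) →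
                    sumOver (ints a m) f ≤ sumOver (ints a m) g
sumOver-ints-mono a zero f g h = z≤n
sumOver-ints-mono a (suc m) f g h = subst (λ l → sumOver l f ≤ sumOver l g) (sym (ints-suc a m))
  (+-mono-≤ (h a ≤-refl (m<m+n a z<s)) (sumOver-ints-mono (suc a) m f g (restrict-tail a m h)))

sumOver-ints-zero : ∀ a m (f : ℕ → ℕ) → (∀ e → a ≤ e → e < a + m → f e ≡ 0) → sumOver (ints a m) f ≡ 0
sumOver-ints-zero a m f h = n≤0⇒n≡0 (≤-trans
  (sumOver-ints-mono a m f (λ _ → 0) (λ e p q → ≤-reflexive (h e p q)))
  (≤-reflexive (sumOver-const0 (ints a m))))

sumOver-ints-one : ∀ a m (f : ℕ → ℕ) → (∀ e → a ≤ e → e < a + m → f e ≡ 1) → sumOver (ints a m) f ≡ m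
sumOver-ints-one a zero f h = refl
sumOver-ints-one a (suc m) f h = trans (cong (λ l → sumOver l f) (ints-suc a m))
  (cong₂ _+_ (h a ≤-refl (m<m+n a z<s)) (sumOver-ints-one (suc a) m f (restrict-tail a m h)))

IsPrefix : List ℕ → List ℕ → Set
IsPrefix u w = Σ (List ℕ) λ v → w ≡ u ++ v

prefix-++ : ∀ u v → IsPrefix u (u ++ v)
prefix-++ u v = v , refl

prefix-cong : ∀ x {u w} → IsPrefix u w → IsPrefix (x ++ u) (x ++ w)
prefix-cong x {u} (v , eq) = v , trans (cong (x ++_) eq) (sym (++-assoc x u v))

prefix-trans : ∀ {a b d} → IsPrefix a b → IsPrefix b d → IsPrefix a d
prefix-trans {a} (v₁ , e₁) (v₂ , e₂) = v₁ ++ v₂ , trans e₂ (trans (cong (_++ v₂) e₁) (++-assoc a v₁ v₂))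

take-prefix : ∀ (u v : List ℕ) → take (length u) (u ++ v) ≡ u
take-prefix [] v = refl
take-prefix (x ∷ u) v = cong (x ∷_) (take-prefix u v)

concat-map-++ : ∀ (g : ℕ → List ℕ) X Y → concat (map g (X ++ Y)) ≡ concat (map g X) ++ concat (map g Y)
concat-map-++ g [] Y = refl
concat-map-++ g (x ∷ X) Y = trans (cong (g x ++_) (concat-map-++ g X Y)) (sym (++-assoc (g x) _ _))

All-at : ∀ {P : ℕ → Set} as {z} ys → All P (as ++ z ∷ ys) → P z
All-at [] ys (pz ∷ _) = pz
All-at (a ∷ as) ys (_ ∷ rest) = All-at as ys rest

All-fromSplits : ∀ {P : ℕ → Set} xs → (∀ as z ys → xs ≡ as ++ z ∷ ys → P z) → All P xs
All-fromSplits [] h = []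
All-fromSplits (x ∷ xs) h = h [] x xs refl ∷ All-fromSplits xs (λ as z ys e → h (x ∷ as) z ys (cong (x ∷_) e))

linked-after : ∀ as {z} ys → Linked _<_ (as ++ z ∷ ys) → All (z <_) ys
linked-after [] [] _ = []
linked-after [] (y ∷ ys) (z<y ∷ rest) = Linked⇒All <-trans z<y rest
linked-after (a ∷ []) ys (_ ∷ rest) = linked-after [] ys rest
linked-after (a ∷ b ∷ as) ys (_ ∷ rest) = linked-after (b ∷ as) ys rest

≤ˢ-trans : ∀ a b d → 1 ≤ length b → a ≤ˢ b → b ≤ˢ d → a ≤ˢ d
≤ˢ-trans a (y ∷ b) d _ a≤b (y≤d ∷ _) = All-map (λ { (x≤y ∷ _) → All-map (≤-trans x≤y) y≤d }) a≤b

<ˢ-trans : ∀ a b d → 1 ≤ length b → a <ˢ b → b <ˢ d → a <ˢ d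
<ˢ-trans a (y ∷ b) d _ a<b (y<d ∷ _) = All-map (λ { (x<y ∷ _) → All-map (<-trans x<y) y<d }) a<b

boxShape : ∀ {a b : ℕ} {Q : Set} xs → Linked _<_ xs → 1 ≤ length xs →
  All (λ z → z ≡ b ⊎ (z ≡ a × Q)) xs → (Q → a < b) →
  (xs ≡ b ∷ []) ⊎ (Q × ((xs ≡ a ∷ []) ⊎ (xs ≡ a ∷ b ∷ [])))
boxShape (x ∷ []) _ _ (inj₁ refl ∷ []) a<b = inj₁ refl
boxShape (x ∷ []) _ _ (inj₂ (refl , q) ∷ []) a<b = inj₂ (q , inj₁ refl)
boxShape (x ∷ y ∷ zs) (x<y ∷ _) _ (inj₁ refl ∷ inj₁ refl ∷ _) a<b = ⊥-elim (<-irrefl refl x<y)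
boxShape (x ∷ y ∷ zs) (x<y ∷ _) _ (inj₁ refl ∷ inj₂ (refl , q) ∷ _) a<b = ⊥-elim (<-asym x<y (a<b q))
boxShape (x ∷ y ∷ zs) (x<y ∷ _) _ (inj₂ (refl , q) ∷ inj₂ (refl , _) ∷ _) a<b = ⊥-elim (<-irrefl refl x<y)
boxShape (x ∷ y ∷ []) _ _ (inj₂ (refl , q) ∷ inj₁ refl ∷ []) a<b = inj₂ (q , inj₂ refl)
boxShape (x ∷ y ∷ z ∷ zs) (_ ∷ y<z ∷ _) _ (inj₂ (refl , _) ∷ inj₁ refl ∷ inj₁ refl ∷ _) a<b = ⊥-elim (<-irrefl refl y<z)
boxShape (x ∷ y ∷ z ∷ zs) (x<y ∷ y<z ∷ _) _ (inj₂ (refl , _) ∷ inj₁ refl ∷ inj₂ (refl , _) ∷ _) a<b =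
  ⊥-elim (<-irrefl refl (<-trans x<y y<z))

gap-+ : ∀ {c c'} → c < c' → suc (c' ∸ suc c) + c ≡ c'
gap-+ {c} {c'} c<c' = trans (sym (+-suc (c' ∸ suc c) c)) (m∸n+n≡m c<c')

count-with-last : ∀ L a b d → suc L ≤ L + (a + (b + (d + 1)))
count-with-last L a b d = subst (suc L ≤_) (sym (regroup L a b d)) (m≤m+n (suc L) (a + (b + d)))
  where
  regroup : ∀ L a b d → L + (a + (b + (d + 1))) ≡ suc L + (a + (b + d))
  regroup = solve-∀

count-with-last′ : ∀ a S R d → suc (S + R) ≤ a + (S + (R + (d + 1)))
count-with-last′ a S R d = subst (suc (S + R) ≤_) (sym (regroup a S R d)) (m≤m+n (suc (S + R)) (a + d))
  where
  regroup : ∀ a S R d → a + (S + (R + (d + 1))) ≡ suc (S + R) + (a + d)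
  regroup = solve-∀

-- Rectangle blocks

module RectangleBlock (T : Filling) (B L r₀ c₀ h w : ℕ) (W rest : List ℕ)
  (boxValid : ∀ r c → r₀ < r → r ≤ r₀ + h → c₀ < c → c ≤ c₀ + w → ValidSet (T r c))
  (rowWeak : ∀ r c → r₀ < r → r ≤ r₀ + h → c₀ < c → suc c ≤ c₀ + w → T r c ≤ˢ T r (suc c))
  (colStrict : ∀ r c → r₀ < r → suc r ≤ r₀ + h → c₀ < c → c ≤ c₀ + w → T r c <ˢ T (suc r) c)
  (prefixLow : ∀ x → 1 ≤ x → x ≤ B → occ x W ≡ L)
  (prefixHigh : ∀ x → B < x → occ x W ≡ 0)
  (lattice : ∀ u v → W ++ (concat (map (λ r → rowWord T r (ints (suc c₀) w)) (ints (suc r₀) h)) ++ rest) ≡ u ++ v →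
             ∀ i → occ (suc (suc i)) u ≤ occ (suc i) u)
  where

  cols : List ℕ
  cols = ints (suc c₀) w

  rowW : ℕ → List ℕ
  rowW r = rowWord T r cols

  blockW : ℕ → List ℕ
  blockW j = concat (map rowW (ints (suc r₀) j))

  column : ℕ → ℕ → List ℕ
  column j c = concat (map (λ r → T r c) (ints (suc r₀) j))

  countLow countHigh : List ℕ → ℕ
  countLow [] = 0
  countLow (x ∷ xs) with x ≤? B
  ... | yes _ = suc (countLow xs)
  ... | no _ = countLow xs
  countHigh [] = 0
  countHigh (x ∷ xs) with x ≤? B
  ... | yes _ = countHigh xs
  ... | no _ = suc (countHigh xs)

  countLow-≤ : ∀ {x} xs → x ≤ B → countLow (x ∷ xs) ≡ suc (countLow xs)
  countLow-≤ {x} xs x≤B with x ≤? B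
  ... | yes _ = refl
  ... | no x≰B = ⊥-elim (x≰B x≤B)

  countLow-> : ∀ {x} xs → B < x → countLow (x ∷ xs) ≡ countLow xs
  countLow-> {x} xs B<x with x ≤? B
  ... | yes x≤B = ⊥-elim (<⇒≱ B<x x≤B)
  ... | no _ = refl

  countHigh-≤ : ∀ {x} xs → x ≤ B → countHigh (x ∷ xs) ≡ countHigh xs
  countHigh-≤ {x} xs x≤B with x ≤? B
  ... | yes _ = refl
  ... | no x≰B = ⊥-elim (x≰B x≤B)

  countHigh-> : ∀ {x} xs → B < x → countHigh (x ∷ xs) ≡ suc (countHigh xs)
  countHigh-> {x} xs B<x with x ≤? B
  ... | yes x≤B = ⊥-elim (<⇒≱ B<x x≤B)
  ... | no _ = refl

  countLow-++ : ∀ a b → countLow (a ++ b) ≡ countLow a + countLow b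
  countLow-++ [] b = refl
  countLow-++ (x ∷ a) b with x ≤? B
  ... | yes _ = cong suc (countLow-++ a b)
  ... | no _ = countLow-++ a b

  countHigh-++ : ∀ a b → countHigh (a ++ b) ≡ countHigh a + countHigh b
  countHigh-++ [] b = refl
  countHigh-++ (x ∷ a) b with x ≤? B
  ... | yes _ = countHigh-++ a b
  ... | no _ = cong suc (countHigh-++ a b)

  -- the lengths p and u of the two runs of column c after j rows
  P U : ℕ → ℕ → ℕ
  P j c = countLow (column j c)
  U j c = countHigh (column j c)

  record ColumnShape (j c p u : ℕ) : Set where
    field
      shape : column j c ≡ ints 1 p ++ ints (suc B) u
      p≤B : p ≤ B
      p≤j : p ≤ j
      u≤j : u ≤ j
      j≤p+u : j ≤ p + u
      double : ∀ r → r₀ < r → r ≤ r₀ + j → 2 ≤ length (T r c) →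
               (T r c ≡ p ∷ suc B ∷ []) × (1 ≤ u) ×
               (∀ r' → r₀ < r' → r' ≤ r₀ + j → 2 ≤ length (T r' c) → r ≡ r')

  ColumnInv : ℕ → ℕ → Set
  ColumnInv j c = ColumnShape j c (P j c) (U j c)

  RowsInv : ℕ → Set
  RowsInv j = (∀ c → c₀ < c → c ≤ c₀ + w → ColumnInv j c) ×
              (∀ c c' → c₀ < c → c' ≤ c₀ + w → c ≤ c' → U j c ≤ U j c')

  rowsInv-0 : RowsInv 0
  rowsInv-0 = (λ c _ _ → record
                { shape = refl ; p≤B = z≤n ; p≤j = z≤n ; u≤j = z≤n ; j≤p+u = z≤n
                ; double = λ r r₀<r r≤r₀ _ → ⊥-elim (<⇒≱ r₀<r (≤-trans r≤r₀ (≤-reflexive (+-identityʳ r₀)))) })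
            , (λ _ _ _ _ _ → z≤n)

  rowChain : ∀ r c d → r₀ < r → r ≤ r₀ + h → c₀ < c → suc d + c ≤ c₀ + w → T r c ≤ˢ T r (suc d + c)
  rowChain r c zero ra rb ca cb = rowWeak r c ra rb ca cb
  rowChain r c (suc d) ra rb ca cb =
    ≤ˢ-trans (T r c) (T r (suc d + c)) (T r (suc (suc d + c)))
      (proj₁ (boxValid r (suc d + c) ra rb c₀<mid (≤-trans (n≤1+n _) cb)))
      (rowChain r c d ra rb ca (≤-trans (n≤1+n _) cb))
      (rowWeak r (suc d + c) ra rb c₀<mid cb)
    where
    c₀<mid : c₀ < suc d + c
    c₀<mid = ≤-trans ca (≤-trans (n≤1+n c) (s≤s (m≤n+m c d)))

  row-≤ˢ : ∀ r c c' → r₀ < r → r ≤ r₀ + h → c₀ < c → c < c' → c' ≤ c₀ + w → T r c ≤ˢ T r c'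
  row-≤ˢ r c c' ra rb ca c<c' c'b = subst (λ e → T r c ≤ˢ T r e) (gap-+ c<c')
    (rowChain r c (c' ∸ suc c) ra rb ca (≤-trans (≤-reflexive (gap-+ c<c')) c'b))

  colChain : ∀ r c d → r₀ < r → suc d + r ≤ r₀ + h → c₀ < c → c ≤ c₀ + w → T r c <ˢ T (suc d + r) c
  colChain r c zero ra rb ca cb = colStrict r c ra rb ca cb
  colChain r c (suc d) ra rb ca cb =
    <ˢ-trans (T r c) (T (suc d + r) c) (T (suc (suc d + r)) c)
      (proj₁ (boxValid (suc d + r) c r₀<mid (≤-trans (n≤1+n _) rb) ca cb))
      (colChain r c d ra (≤-trans (n≤1+n _) rb) ca cb)
      (colStrict (suc d + r) c r₀<mid rb ca cb)
    where
    r₀<mid : r₀ < suc d + r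
    r₀<mid = ≤-trans ra (≤-trans (n≤1+n r) (s≤s (m≤n+m r d)))

  col-<ˢ : ∀ r r' c → r₀ < r → r < r' → r' ≤ r₀ + h → c₀ < c → c ≤ c₀ + w → T r c <ˢ T r' c
  col-<ˢ r r' c ra r<r' r'b ca cb = subst (λ e → T r c <ˢ T e c) (gap-+ r<r')
    (colChain r c (r' ∸ suc r) ra (≤-trans (≤-reflexive (gap-+ r<r')) r'b) ca cb)

  occ-rowW : ∀ x r → occ x (rowW r) ≡ sumOver cols (λ c → occ x (T r c))
  occ-rowW x r = trans (occ-concat-map x (λ c → reverse (T r c)) (reverse cols))
    (trans (sumOver-reverse cols (λ c → occ x (reverse (T r c))))
           (sumOver-cong cols (λ c → occ-reverse x (T r c))))

  occ-blockW : ∀ x j → occ x (blockW j) ≡ sumOver cols (λ c → occ x (column j c))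
  occ-blockW x j = trans (occ-concat-map x rowW (ints (suc r₀) j))
    (trans (sumOver-cong (ints (suc r₀) j) (λ r → occ-rowW x r))
    (trans (sumOver-swap (ints (suc r₀) j) cols (λ r c → occ x (T r c)))
           (sumOver-cong cols (λ c → sym (occ-concat-map x (λ r → T r c) (ints (suc r₀) j))))))

  lattice-prefix : ∀ {u} → IsPrefix u (W ++ (blockW h ++ rest)) → ∀ i → occ (suc (suc i)) u ≤ occ (suc i) u
  lattice-prefix {u} (v , eq) = lattice u v eq

  column-suc : ∀ j c → column (suc j) c ≡ column j c ++ T (suc (r₀ + j)) c
  column-suc j c = begin
    concat (map (λ r → T r c) (ints (suc r₀) (suc j)))
      ≡⟨ cong (λ l → concat (map (λ r → T r c) l)) (ints-snoc (suc r₀) j) ⟩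
    concat (map (λ r → T r c) (ints (suc r₀) j ++ [ suc (r₀ + j) ]))
      ≡⟨ concat-map-++ (λ r → T r c) (ints (suc r₀) j) _ ⟩
    column j c ++ (T (suc (r₀ + j)) c ++ [])
      ≡⟨ cong (column j c ++_) (++-identityʳ _) ⟩
    column j c ++ T (suc (r₀ + j)) c ∎
    where open ≡-Reasoning

  occ-column : ∀ x j c → ColumnInv j c → occ x (column j c) ≡ occ x (ints 1 (P j c)) + occ x (ints (suc B) (U j c))
  occ-column x j c ci = trans (cong (occ x) (ColumnShape.shape ci)) (occ-++ x (ints 1 (P j c)) _)

  module NextRow (j : ℕ) (j<h : j < h) (inv : RowsInv j) where
    r : ℕ
    r = suc (r₀ + j)

    r₀<r : r₀ < r
    r₀<r = s≤s (m≤m+n r₀ j)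
    r≤end : r ≤ r₀ + h
    r≤end = ≤-trans (≤-reflexive (sym (+-suc r₀ j))) (+-monoʳ-≤ r₀ j<h)

    colInv : ∀ c → c₀ < c → c ≤ c₀ + w → ColumnInv j c
    colInv = proj₁ inv
    U-mono : ∀ c c' → c₀ < c → c' ≤ c₀ + w → c ≤ c' → U j c ≤ U j c'
    U-mono = proj₂ inv

    -- the entry that would extend the high run of column c
    next-high : ℕ → ℕ
    next-high c = suc (B + U j c)

    B<next-high : ∀ c → B < next-high c
    B<next-high c = s≤s (m≤m+n B (U j c))

    -- the low run of column c may still grow: it is the whole column
    LowOpen : ℕ → Set
    LowOpen c = (U j c ≡ 0) × (P j c ≡ j) × (suc j ≤ B)

    NewBox : ℕ → Set
    NewBox c = (T r c ≡ next-high c ∷ []) ⊎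
               (LowOpen c × ((T r c ≡ suc j ∷ []) ⊎ (T r c ≡ suc j ∷ next-high c ∷ [])))

    Allowed : ℕ → ℕ → Set
    Allowed c z = (z ≡ next-high c) ⊎ ((z ≡ suc j) × LowOpen c)

    rows-prefix : IsPrefix (blockW j ++ rowW r) (blockW h)
    rows-prefix = blockW-rest , (begin
      concat (map rowW (ints (suc r₀) h))                  ≡⟨ cong (λ m → concat (map rowW (ints (suc r₀) m))) h-split ⟩
      concat (map rowW (ints (suc r₀) (j + suc k)))        ≡⟨ cong (λ l → concat (map rowW l)) (ints-around (suc r₀) j k) ⟩
      concat (map rowW (ints (suc r₀) j ++ r ∷ ints (suc r) k))
                                                           ≡⟨ concat-map-++ rowW (ints (suc r₀) j) _ ⟩
      blockW j ++ (rowW r ++ blockW-rest)                  ≡⟨ sym (++-assoc (blockW j) (rowW r) _) ⟩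
      (blockW j ++ rowW r) ++ blockW-rest                  ∎)
      where
      open ≡-Reasoning
      k : ℕ
      k = h ∸ suc j
      blockW-rest : List ℕ
      blockW-rest = concat (map rowW (ints (suc r) k))
      h-split : h ≡ j + suc k
      h-split = sym (trans (+-suc j k) (m+[n∸m]≡n j<h))

    module Box (c : ℕ) (c₀<c : c₀ < c) (c≤end : c ≤ c₀ + w)
               (rightNew : ∀ c' → c < c' → c' ≤ c₀ + w → NewBox c') where
      valid : ValidSet (T r c)
      valid = boxValid r c r₀<r r≤end c₀<c c≤end
      ci : ColumnInv j c
      ci = colInv c c₀<c c≤end
      p u : ℕ
      p = P j c
      u = U j c

      dL dR : ℕ
      dL = c ∸ suc c₀
      dR = c₀ + w ∸ c
      c-left : suc c₀ + dL ≡ c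
      c-left = m+[n∸m]≡n c₀<c
      c-right : c + dR ≡ c₀ + w
      c-right = m+[n∸m]≡n c≤end
      w-split : w ≡ dL + suc dR
      w-split = +-cancelˡ-≡ c₀ w (dL + suc dR) (begin
        c₀ + w                ≡⟨ sym c-right ⟩
        c + dR                ≡⟨ cong (_+ dR) (sym c-left) ⟩
        suc (c₀ + dL) + dR    ≡⟨ sym (+-suc (c₀ + dL) dR) ⟩
        (c₀ + dL) + suc dR    ≡⟨ +-assoc c₀ dL (suc dR) ⟩
        c₀ + (dL + suc dR)    ∎)
        where open ≡-Reasoning

      leftcols rightcols : List ℕ
      leftcols = ints (suc c₀) dL
      rightcols = ints (suc c) dR

      cols-around : cols ≡ leftcols ++ c ∷ rightcols
      cols-around = trans (cong (ints (suc c₀)) w-split)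
        (trans (ints-around (suc c₀) dL dR) (cong (λ e → leftcols ++ e ∷ ints (suc e) dR) c-left))

      cols-upto : cols ≡ ints (suc c₀) (suc dL) ++ rightcols
      cols-upto = trans cols-around (trans (sym (++-assoc leftcols [ c ] rightcols))
        (cong (_++ rightcols) (sym (trans (ints-snoc (suc c₀) dL) (cong (λ e → leftcols ++ [ e ]) c-left)))))

      revBox : ℕ → List ℕ
      revBox c' = reverse (T r c')

      -- the part of row r read before box c
      rightW : List ℕ
      rightW = concat (map revBox (reverse rightcols))

      row-prefix : IsPrefix (rightW ++ revBox c) (rowW r)
      row-prefix = concat (map revBox (reverse leftcols)) , (begin
        concat (map revBox (reverse cols))
          ≡⟨ cong (λ l → concat (map revBox (reverse l))) cols-around ⟩
        concat (map revBox (reverse (leftcols ++ c ∷ rightcols)))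
          ≡⟨ cong (λ l → concat (map revBox l)) (reverse-++ leftcols (c ∷ rightcols)) ⟩
        concat (map revBox (reverse (c ∷ rightcols) ++ reverse leftcols))
          ≡⟨ cong (λ l → concat (map revBox (l ++ reverse leftcols))) (unfold-reverse c rightcols) ⟩
        concat (map revBox ((reverse rightcols ++ [ c ]) ++ reverse leftcols))
          ≡⟨ concat-map-++ revBox (reverse rightcols ++ [ c ]) _ ⟩
        concat (map revBox (reverse rightcols ++ [ c ])) ++ leftW
          ≡⟨ cong (_++ leftW) (concat-map-++ revBox (reverse rightcols) [ c ]) ⟩
        (rightW ++ (revBox c ++ [])) ++ leftW
          ≡⟨ cong (λ l → (rightW ++ l) ++ leftW) (++-identityʳ (revBox c)) ⟩
        (rightW ++ revBox c) ++ leftW ∎)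
        where
        open ≡-Reasoning
        leftW : List ℕ
        leftW = concat (map revBox (reverse leftcols))

      occ-rightW : ∀ x → occ x rightW ≡ sumOver rightcols (λ c' → occ x (T r c'))
      occ-rightW x = trans (occ-concat-map x revBox (reverse rightcols))
        (trans (sumOver-reverse rightcols (λ c' → occ x (revBox c')))
               (sumOver-cong rightcols (λ c' → occ-reverse x (T r c'))))

      module Entry (as : List ℕ) (z : ℕ) (ys : List ℕ) (box≡ : T r c ≡ as ++ z ∷ ys) where
        1≤z : 1 ≤ z
        1≤z = All-at as ys (subst (All (1 ≤_)) box≡ (proj₂ (proj₂ valid)))

        z<ys : All (z <_) ys
        z<ys = linked-after as ys (subst (Linked _<_) box≡ (proj₁ (proj₂ valid)))

        column<z : All (_< z) (ints 1 p ++ ints (suc B) u)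
        column<z = subst (All (_< z)) (ColumnShape.shape ci)
          (concat⁺ (map⁺ (All-ints (suc r₀) j (λ r' r₀<r' r'<r →
            All-map (λ below → All-at as ys (subst (All (λ y → _ < y)) box≡ below))
                    (col-<ˢ r' r c r₀<r' r'<r r≤end c₀<c c≤end)))))

        z≤right : ∀ c' → c < c' → c' ≤ c₀ + w → All (z ≤_) (T r c')
        z≤right c' c<c' c'≤end = All-at as ys
          (subst (All (λ x → All (x ≤_) (T r c'))) box≡ (row-≤ˢ r c c' r₀<r r≤end c₀<c c<c' c'≤end))

        box-prefix : IsPrefix (reverse ys ++ [ z ]) (reverse (T r c))
        box-prefix = reverse as , (begin
          reverse (T r c)                 ≡⟨ cong reverse box≡ ⟩
          reverse (as ++ z ∷ ys)          ≡⟨ reverse-++ as (z ∷ ys) ⟩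
          reverse (z ∷ ys) ++ reverse as  ≡⟨ cong (_++ reverse as) (unfold-reverse z ys) ⟩
          (reverse ys ++ [ z ]) ++ reverse as ∎)
          where open ≡-Reasoning

        Pre : List ℕ
        Pre = W ++ (blockW j ++ (rightW ++ (reverse ys ++ [ z ])))

        Pre-prefix : IsPrefix Pre (W ++ (blockW h ++ rest))
        Pre-prefix = prefix-cong W (prefix-trans (prefix-trans
          (prefix-cong (blockW j) (prefix-trans (prefix-cong rightW box-prefix) row-prefix))
          rows-prefix) (prefix-++ (blockW h) rest))

        occ-Pre : ∀ x → occ x Pre ≡ occ x W + (occ x (blockW j) + (occ x rightW + (occ x (reverse ys) + occ x [ z ])))
        occ-Pre x = trans (occ-++ x W _) (cong (occ x W +_) (trans (occ-++ x (blockW j) _)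
          (cong (occ x (blockW j) +_) (trans (occ-++ x rightW _) (cong (occ x rightW +_) (occ-++ x (reverse ys) [ z ]))))))

        lattice-at-z : ∀ i → suc (suc i) ≡ z → occ z Pre ≤ occ (suc i) Pre
        lattice-at-z i eq = subst (λ e → occ e Pre ≤ occ (suc i) Pre) eq (lattice-prefix Pre-prefix i)

        rightW-absent : ∀ x → x < z → occ x rightW ≡ 0
        rightW-absent x x<z = trans (occ-rightW x) (sumOver-ints-zero (suc c) dR (λ c' → occ x (T r c'))
          (λ c' c<c' c'<end → occ-absent x (T r c') (All-map (λ z≤y x≡y → <-irrefl (sym x≡y) (<-≤-trans x<z z≤y))
            (z≤right c' c<c' (≤-trans (≤-pred c'<end) (≤-reflexive c-right))))))

        ys-absent : ∀ x → x < z → occ x (reverse ys) ≡ 0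
        ys-absent x x<z = trans (occ-reverse x ys) (occ-absent x ys (All-map (λ z<y x≡y → <-irrefl (sym x≡y) (<-trans x<z z<y)) z<ys))

        z-absent : ∀ x → x < z → occ x [ z ] ≡ 0
        z-absent x x<z = occ-there [] (λ z≡x → <-irrefl (sym z≡x) x<z)

        -- An entry z ≤ B: the high run above it is empty, so the column is
        -- 1, …, p with p = j; column strictness gives z > j, and the lattice
        -- condition gives z ≤ j + 1.
        high-run-empty : z ≤ B → u ≡ 0
        high-run-empty z≤B = n≤0⇒n≡0 (≮⇒≥ λ 1≤u →
          <⇒≱ (≤-trans (m≤m+n (suc B) 0) (<⇒≤ (All-ints-at (suc B) u 0 (++⁻ʳ (ints 1 p) column<z) 1≤u))) z≤B)

        j≤p : u ≡ 0 → j ≤ p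
        j≤p u≡0 = ≤-trans (ColumnShape.j≤p+u ci) (≤-reflexive (trans (cong (p +_) u≡0) (+-identityʳ p)))

        low-too-small : z ≤ B → z ≤ j → ⊥
        low-too-small z≤B z≤j = <⇒≱ p<z z≤p
          where
          z≤p : z ≤ p
          z≤p = ≤-trans z≤j (j≤p (high-run-empty z≤B))
          1≤p : 1 ≤ p
          1≤p = ≤-trans 1≤z z≤p
          p<z : p < z
          p<z = subst (_< z) (m+[n∸m]≡n 1≤p)
                  (All-ints-at 1 p (p ∸ 1) (++⁻ˡ (ints 1 p) column<z) (≤-reflexive (m+[n∸m]≡n 1≤p)))

        -- if j+1 < z ≤ B then z-1 does not occur in the block so far, so the
        -- prefix has L copies of z-1 but L+1 copies of z
        low-too-large : z ≤ B → suc j < z → ⊥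
        low-too-large z≤B j+1<z = <⇒≱ z-count (≤-trans (lattice-at-z i z≡) pred-count)
          where
          i : ℕ
          i = z ∸ 2
          z≡ : suc (suc i) ≡ z
          z≡ = m+[n∸m]≡n (≤-trans (s≤s (s≤s z≤n)) j+1<z)
          x<z : suc i < z
          x<z = ≤-reflexive z≡
          x≤B : suc i ≤ B
          x≤B = ≤-trans (<⇒≤ x<z) z≤B
          j<x : suc j ≤ suc i
          j<x = ≤-pred (≤-trans j+1<z (≤-reflexive (sym z≡)))
          block-absent : occ (suc i) (blockW j) ≡ 0
          block-absent = trans (occ-blockW (suc i) j) (sumOver-ints-zero (suc c₀) w (λ c' → occ (suc i) (column j c'))
            (λ c' c₀<c' c'<end → let ci' : ColumnInv j c'
                                     ci' = colInv c' c₀<c' (≤-pred c'<end) in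
              trans (occ-column (suc i) j c' ci')
                (cong₂ _+_ (occ-ints-outside (suc i) 1 (P j c') (inj₂ (≤-trans (s≤s (ColumnShape.p≤j ci')) j<x)))
                           (occ-ints-outside (suc i) (suc B) (U j c') (inj₁ (s≤s x≤B))))))
          pred-count : occ (suc i) Pre ≤ L
          pred-count = ≤-reflexive (trans (occ-Pre (suc i))
            (trans (cong₂ _+_ (prefixLow (suc i) (s≤s z≤n) x≤B)
              (cong₂ _+_ block-absent (cong₂ _+_ (rightW-absent (suc i) x<z)
                (cong₂ _+_ (ys-absent (suc i) x<z) (z-absent (suc i) x<z)))))
              (+-identityʳ L)))
          z-count : suc L ≤ occ z Pre
          z-count = subst (suc L ≤_) (sym (trans (occ-Pre z) (cong₂ _+_ (prefixLow z 1≤z z≤B)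
                      (cong (λ e → occ z (blockW j) + (occ z rightW + (occ z (reverse ys) + e))) (occ-singleton z)))))
                    (count-with-last L (occ z (blockW j)) (occ z rightW) (occ z (reverse ys)))

        low-entry : z ≤ B → Allowed c z
        low-entry z≤B with <-cmp z (suc j)
        ... | tri< z<j+1 _ _ = ⊥-elim (low-too-small z≤B (≤-pred z<j+1))
        ... | tri≈ _ z≡j+1 _ = inj₂ (z≡j+1 , high-run-empty z≤B ,
                ≤-antisym (ColumnShape.p≤j ci) (j≤p (high-run-empty z≤B)) , subst (_≤ B) z≡j+1 z≤B)
        ... | tri> _ _ j+1<z = ⊥-elim (low-too-large z≤B j+1<z)

        -- An entry z = B + 1 + t > B.  Column strictness gives t ≥ u; if
        -- t > u, then every column holding z - 1 above row r is matched by
        -- an occurrence of z in the same column or in row r to the right of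
        -- c, so the prefix ending at z violates the lattice condition.
        module HighEntry (B<z : B < z) where
          t : ℕ
          t = z ∸ suc B
          z≡ : suc B + t ≡ z
          z≡ = m+[n∸m]≡n B<z

          high-too-small : t < u → ⊥
          high-too-small t<u = <-irrefl z≡ (All-ints-at (suc B) u t (++⁻ʳ (ints 1 p) column<z) t<u)

          module TooLarge (u<t : u < t) where
            1≤t : 1 ≤ t
            1≤t = ≤-trans (s≤s z≤n) u<t
            t′ : ℕ
            t′ = t ∸ 1
            t≡ : suc t′ ≡ t
            t≡ = m+[n∸m]≡n 1≤t
            u≤t′ : u ≤ t′
            u≤t′ = ≤-pred (subst (u <_) (sym t≡) u<t)

            -- x = z - 1
            x : ℕ
            x = suc (B + t′)
            x+1≡z : suc x ≡ z
            x+1≡z = trans (cong suc (sym (+-suc B t′))) (trans (cong (λ e → suc (B + e)) t≡) z≡)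
            x<z : x < z
            x<z = ≤-reflexive x+1≡z

            fx fz : ℕ → ℕ
            fx c' = occ x (column j c')
            fz c' = occ z (column j c')
            Sx Sz Rz : ℕ
            Sx = sumOver cols fx
            Sz = sumOver cols fz
            Rz = sumOver rightcols (λ c' → occ z (T r c'))

            x-count : occ x Pre ≡ Sx
            x-count = trans (occ-Pre x)
              (cong₂ _+_ (prefixHigh x (s≤s (m≤m+n B t′)))
                 (trans (cong₂ _+_ (occ-blockW x j) (cong₂ _+_ (rightW-absent x x<z) (cong₂ _+_ (ys-absent x x<z) (z-absent x x<z))))
                        (+-identityʳ Sx)))

            z-count : suc (Sz + Rz) ≤ occ z Pre
            z-count = subst (suc (Sz + Rz) ≤_)
              (sym (trans (occ-Pre z) (cong (occ z W +_) (cong₂ _+_ (occ-blockW z j)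
                 (cong₂ _+_ (occ-rightW z) (cong (occ z (reverse ys) +_) (occ-singleton z)))))))
              (count-with-last′ (occ z W) Sz Rz (occ z (reverse ys)))

            x-absent : ∀ c' → ColumnInv j c' → U j c' ≤ t′ → fx c' ≡ 0
            x-absent c' ci' U≤t′ = trans (occ-column x j c' ci')
              (cong₂ _+_ (occ-ints-outside x 1 (P j c') (inj₂ (s≤s (≤-trans (ColumnShape.p≤B ci') (m≤m+n B t′)))))
                         (occ-ints-outside x (suc B) (U j c') (inj₂ (s≤s (+-monoʳ-≤ B U≤t′)))))

            -- columns up to c: their high runs are at most u ≤ t′ long
            left-absent : sumOver (ints (suc c₀) (suc dL)) fx ≡ 0
            left-absent = sumOver-ints-zero (suc c₀) (suc dL) fx (λ c' c₀<c' c'<end →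
              let c'≤c : c' ≤ c
                  c'≤c = ≤-pred (≤-trans c'<end (≤-reflexive (trans (+-suc (suc c₀) dL) (cong suc c-left))))
              in x-absent c' (colInv c' c₀<c' (≤-trans c'≤c c≤end)) (≤-trans (U-mono c' c c₀<c' c≤end c'≤c) u≤t′))

            right-matched : ∀ c' → c < c' → c' ≤ c₀ + w → fx c' ≤ fz c' + occ z (T r c')
            right-matched c' c<c' c'≤end with <-cmp t′ (U j c')
            ... | tri> _ _ U<t′ = subst (_≤ _) (sym (x-absent c' ci' (<⇒≤ U<t′))) z≤n
              where
              ci' : ColumnInv j c'
              ci' = colInv c' (<-trans c₀<c c<c') c'≤end
            ... | tri≈ _ t′≡U _ = subst (_≤ _) (sym (x-absent c' ci' (≤-reflexive (sym t′≡U)))) z≤n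
              where
              ci' : ColumnInv j c'
              ci' = colInv c' (<-trans c₀<c c<c') c'≤end
            ... | tri< t′<U _ _ = ≤-trans x-at-most-once z-present
              where
              ci' : ColumnInv j c'
              ci' = colInv c' (<-trans c₀<c c<c') c'≤end
              x-at-most-once : fx c' ≤ 1
              x-at-most-once = ≤-trans (≤-reflexive (trans (occ-column x j c' ci')
                (cong (_+ occ x (ints (suc B) (U j c')))
                  (occ-ints-outside x 1 (P j c') (inj₂ (s≤s (≤-trans (ColumnShape.p≤B ci') (m≤m+n B t′))))))))
                (occ-ints-≤1 x (suc B) (U j c'))
              z-present : 1 ≤ fz c' + occ z (T r c')
              z-present with m≤n⇒m<n∨m≡n t′<U
              ... | inj₁ t<U = ≤-trans (≤-reflexive (sym (occ-ints-inside z (suc B) (U j c') B<z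
                                 (subst (_< suc B + U j c') z≡ (+-monoʳ-< (suc B) (subst (_< U j c') t≡ t<U))))))
                               (≤-trans (m≤n+m _ (occ z (ints 1 (P j c'))))
                               (≤-trans (≤-reflexive (sym (occ-column z j c' ci'))) (m≤m+n (fz c') _)))
              ... | inj₂ t≡U with rightNew c' c<c' c'≤end
              ...   | inj₂ (lowOpen , _) = ⊥-elim (0≢1+n (sym (trans t≡U (proj₁ lowOpen))))
              ...   | inj₁ box≡ = ≤-trans (≤-reflexive (sym (trans (cong (occ z) box≡)
                                    (subst (λ v → occ z (v ∷ []) ≡ 1) z≡next (occ-singleton z)))))
                                  (m≤n+m _ (fz c'))
                where
                z≡next : z ≡ next-high c'
                z≡next = trans (sym z≡) (cong (λ v → suc (B + v)) (trans (sym t≡) t≡U))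

            split-at-c : ∀ f → sumOver cols f ≡ sumOver (ints (suc c₀) (suc dL)) f + sumOver rightcols f
            split-at-c f = trans (cong (λ l → sumOver l f) cols-upto) (sumOver-++ (ints (suc c₀) (suc dL)) rightcols f)

            x≤z-counts : Sx ≤ Sz + Rz
            x≤z-counts = begin
              Sx                                                   ≡⟨ split-at-c fx ⟩
              sumOver (ints (suc c₀) (suc dL)) fx + sumOver rightcols fx ≡⟨ cong (_+ sumOver rightcols fx) left-absent ⟩
              sumOver rightcols fx                                 ≤⟨ sumOver-ints-mono (suc c) dR fx (λ c' → fz c' + occ z (T r c'))
                                                                        (λ c' c<c' c'<end → right-matched c' c<c' (≤-trans (≤-pred c'<end) (≤-reflexive c-right))) ⟩
              sumOver rightcols (λ c' → fz c' + occ z (T r c'))    ≡⟨ sym (sumOver-+ rightcols fz (λ c' → occ z (T r c'))) ⟩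
              sumOver rightcols fz + Rz                            ≤⟨ +-monoˡ-≤ Rz (m≤n+m _ _) ⟩
              (sumOver (ints (suc c₀) (suc dL)) fz + sumOver rightcols fz) + Rz ≡⟨ cong (_+ Rz) (sym (split-at-c fz)) ⟩
              Sz + Rz                                              ∎
              where open ≤-Reasoning

            contradiction : ⊥
            contradiction = <⇒≱ z-count (≤-trans (lattice-at-z (B + t′) x+1≡z) (≤-trans (≤-reflexive x-count) x≤z-counts))

          high-entry : Allowed c z
          high-entry with <-cmp t u
          ... | tri< t<u _ _ = ⊥-elim (high-too-small t<u)
          ... | tri≈ _ t≡u _ = inj₁ (trans (sym z≡) (cong (λ v → suc (B + v)) t≡u))
          ... | tri> _ _ u<t = ⊥-elim (TooLarge.contradiction u<t)

        allowed : Allowed c z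
        allowed with z ≤? B
        ... | yes z≤B = low-entry z≤B
        ... | no z≰B = HighEntry.high-entry (≰⇒> z≰B)

      newBox : NewBox c
      newBox = boxShape (T r c) (proj₁ (proj₂ valid)) (proj₁ valid)
        (All-fromSplits (T r c) (λ as z ys box≡ → Entry.allowed as z ys box≡))
        (λ { (_ , _ , j+1≤B) → s≤s (≤-trans j+1≤B (m≤m+n B u)) })

    newBox-from-right : ∀ d c → c₀ < c → c ≤ c₀ + w → c₀ + w ≤ c + d → NewBox c
    newBox-from-right zero c c₀<c c≤end end≤c = Box.newBox c c₀<c c≤end
      (λ c' c<c' c'≤end → ⊥-elim (<⇒≱ c<c' (≤-trans c'≤end (≤-trans end≤c (≤-reflexive (+-identityʳ c))))))
    newBox-from-right (suc d) c c₀<c c≤end end≤c+d = Box.newBox c c₀<c c≤end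
      (λ c' c<c' c'≤end → newBox-from-right d c' (<-trans c₀<c c<c') c'≤end
        (≤-trans end≤c+d (≤-trans (≤-reflexive (+-suc c d)) (+-monoˡ-≤ d c<c'))))

    newBox : ∀ c → c₀ < c → c ≤ c₀ + w → NewBox c
    newBox c c₀<c c≤end = newBox-from-right (c₀ + w) c c₀<c c≤end (m≤n+m (c₀ + w) c)

    P-suc : ∀ c → P (suc j) c ≡ P j c + countLow (T r c)
    P-suc c = trans (cong countLow (column-suc j c)) (countLow-++ (column j c) (T r c))
    U-suc : ∀ c → U (suc j) c ≡ U j c + countHigh (T r c)
    U-suc c = trans (cong countHigh (column-suc j c)) (countHigh-++ (column j c) (T r c))

    old-or-new : ∀ r' → r' ≤ r₀ + suc j → r' ≤ r₀ + j ⊎ r' ≡ r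
    old-or-new r' r'≤ with m≤n⇒m<n∨m≡n (≤-trans r'≤ (≤-reflexive (+-suc r₀ j)))
    ... | inj₁ r'<r = inj₁ (≤-pred r'<r)
    ... | inj₂ r'≡r = inj₂ r'≡r

    doubles-are-old : ∀ {c v} → T r c ≡ v ∷ [] → ∀ r' → r' ≤ r₀ + suc j → 2 ≤ length (T r' c) → r' ≤ r₀ + j
    doubles-are-old box≡ r' r'≤ two with old-or-new r' r'≤
    ... | inj₁ old = old
    ... | inj₂ refl with subst (λ l → 2 ≤ length l) box≡ two
    ...   | s≤s ()

    no-old-doubles : ∀ c → c₀ < c → c ≤ c₀ + w → U j c ≡ 0 →
                     ∀ r' → r₀ < r' → r' ≤ r₀ + j → 2 ≤ length (T r' c) → ⊥
    no-old-doubles c c₀<c c≤end U≡0 r' r₀<r' old two with ColumnShape.double (colInv c c₀<c c≤end) r' r₀<r' old two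
    ... | _ , 1≤U , _ = <⇒≱ (subst (1 ≤_) U≡0 1≤U) z≤n

    open-column : ∀ c → c₀ < c → c ≤ c₀ + w → LowOpen c → column j c ≡ ints 1 j
    open-column c c₀<c c≤end (U≡0 , P≡j , _) = trans (ColumnShape.shape (colInv c c₀<c c≤end))
      (trans (cong₂ (λ p' u' → ints 1 p' ++ ints (suc B) u') P≡j U≡0) (++-identityʳ (ints 1 j)))

    grow-high : ∀ c → c₀ < c → c ≤ c₀ + w → T r c ≡ next-high c ∷ [] → ColumnInv (suc j) c
    grow-high c c₀<c c≤end box≡ = subst₂ (ColumnShape (suc j) c)
      (sym (trans (P-suc c) (trans (cong (λ l → P j c + countLow l) box≡)
             (trans (cong (P j c +_) (countLow-> [] (B<next-high c))) (+-identityʳ _)))))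
      (sym (trans (U-suc c) (trans (cong (λ l → U j c + countHigh l) box≡)
             (trans (cong (U j c +_) (countHigh-> [] (B<next-high c))) (+-comm (U j c) 1)))))
      record
        { shape = begin
            column (suc j) c                                              ≡⟨ column-suc j c ⟩
            column j c ++ T r c                                           ≡⟨ cong₂ _++_ (ColumnShape.shape ci) box≡ ⟩
            (ints 1 (P j c) ++ ints (suc B) (U j c)) ++ [ next-high c ]   ≡⟨ ++-assoc (ints 1 (P j c)) _ _ ⟩
            ints 1 (P j c) ++ (ints (suc B) (U j c) ++ [ suc B + U j c ]) ≡⟨ cong (ints 1 (P j c) ++_) (sym (ints-snoc (suc B) (U j c))) ⟩
            ints 1 (P j c) ++ ints (suc B) (suc (U j c))                  ∎
        ; p≤B = ColumnShape.p≤B ci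
        ; p≤j = ≤-trans (ColumnShape.p≤j ci) (n≤1+n j)
        ; u≤j = s≤s (ColumnShape.u≤j ci)
        ; j≤p+u = ≤-trans (s≤s (ColumnShape.j≤p+u ci)) (≤-reflexive (sym (+-suc (P j c) (U j c))))
        ; double = λ r' r₀<r' r'≤ two →
            let (form , _ , unique) = ColumnShape.double ci r' r₀<r' (doubles-are-old box≡ r' r'≤ two) two
            in form , s≤s z≤n , λ r'' r₀<r'' r''≤ two' → unique r'' r₀<r'' (doubles-are-old box≡ r'' r''≤ two') two'
        }
      where
      open ≡-Reasoning
      ci : ColumnInv j c
      ci = colInv c c₀<c c≤end

    grow-low : ∀ c → c₀ < c → c ≤ c₀ + w → LowOpen c → T r c ≡ suc j ∷ [] → ColumnInv (suc j) c
    grow-low c c₀<c c≤end lowOpen@(U≡0 , P≡j , j+1≤B) box≡ = subst₂ (ColumnShape (suc j) c)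
      (sym (trans (P-suc c) (trans (cong (λ l → P j c + countLow l) box≡)
             (trans (cong₂ _+_ P≡j (countLow-≤ [] j+1≤B)) (+-comm j 1)))))
      (sym (trans (U-suc c) (trans (cong (λ l → U j c + countHigh l) box≡)
             (cong₂ _+_ U≡0 (countHigh-≤ [] j+1≤B)))))
      record
        { shape = begin
            column (suc j) c      ≡⟨ column-suc j c ⟩
            column j c ++ T r c   ≡⟨ cong₂ _++_ (open-column c c₀<c c≤end lowOpen) box≡ ⟩
            ints 1 j ++ [ suc j ] ≡⟨ sym (ints-snoc 1 j) ⟩
            ints 1 (suc j)        ≡⟨ sym (++-identityʳ _) ⟩
            ints 1 (suc j) ++ []  ∎
        ; p≤B = j+1≤B
        ; p≤j = ≤-refl
        ; u≤j = z≤n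
        ; j≤p+u = ≤-reflexive (sym (+-identityʳ (suc j)))
        ; double = λ r' r₀<r' r'≤ two →
            ⊥-elim (no-old-doubles c c₀<c c≤end U≡0 r' r₀<r' (doubles-are-old box≡ r' r'≤ two) two)
        }
      where open ≡-Reasoning

    grow-both : ∀ c → c₀ < c → c ≤ c₀ + w → LowOpen c → T r c ≡ suc j ∷ next-high c ∷ [] → ColumnInv (suc j) c
    grow-both c c₀<c c≤end lowOpen@(U≡0 , P≡j , j+1≤B) box≡ = subst₂ (ColumnShape (suc j) c)
      (sym (trans (P-suc c) (trans (cong (λ l → P j c + countLow l) box≡)
             (trans (cong₂ _+_ P≡j (trans (countLow-≤ _ j+1≤B) (cong suc (countLow-> [] (B<next-high c))))) (+-comm j 1)))))
      (sym (trans (U-suc c) (trans (cong (λ l → U j c + countHigh l) box≡)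
             (cong₂ _+_ U≡0 (trans (countHigh-≤ _ j+1≤B) (countHigh-> [] (B<next-high c)))))))
      record
        { shape = begin
            column (suc j) c      ≡⟨ column-suc j c ⟩
            column j c ++ T r c   ≡⟨ cong₂ _++_ (open-column c c₀<c c≤end lowOpen) box≡′ ⟩
            ints 1 j ++ (suc j ∷ suc (B + 0) ∷ []) ≡⟨ ints-snoc₂ j (suc (B + 0)) ⟩
            ints 1 (suc j) ++ ints (suc B) 1       ∎
        ; p≤B = j+1≤B
        ; p≤j = ≤-refl
        ; u≤j = s≤s z≤n
        ; j≤p+u = m≤m+n (suc j) 1
        ; double = new-double
        }
      where
      open ≡-Reasoning
      box≡′ : T r c ≡ suc j ∷ suc (B + 0) ∷ []
      box≡′ = trans box≡ (cong (λ v → suc j ∷ suc (B + v) ∷ []) U≡0)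
      only-new : ∀ r' → r₀ < r' → r' ≤ r₀ + suc j → 2 ≤ length (T r' c) → r' ≡ r
      only-new r' r₀<r' r'≤ two with old-or-new r' r'≤
      ... | inj₁ old = ⊥-elim (no-old-doubles c c₀<c c≤end U≡0 r' r₀<r' old two)
      ... | inj₂ r'≡r = r'≡r
      new-double : ∀ r' → r₀ < r' → r' ≤ r₀ + suc j → 2 ≤ length (T r' c) →
                   (T r' c ≡ suc j ∷ suc B ∷ []) × (1 ≤ 1) ×
                   (∀ r'' → r₀ < r'' → r'' ≤ r₀ + suc j → 2 ≤ length (T r'' c) → r' ≡ r'')
      new-double r' r₀<r' r'≤ two with only-new r' r₀<r' r'≤ two
      ... | refl = trans box≡′ (cong (λ v → suc j ∷ suc v ∷ []) (+-identityʳ B)) , s≤s z≤n ,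
                   λ r'' r₀<r'' r''≤ two' → sym (only-new r'' r₀<r'' r''≤ two')

    newColumn : ∀ c → c₀ < c → c ≤ c₀ + w → ColumnInv (suc j) c
    newColumn c c₀<c c≤end with newBox c c₀<c c≤end
    ... | inj₁ box≡ = grow-high c c₀<c c≤end box≡
    ... | inj₂ (lowOpen , inj₁ box≡) = grow-low c c₀<c c≤end lowOpen box≡
    ... | inj₂ (lowOpen , inj₂ box≡) = grow-both c c₀<c c≤end lowOpen box≡

    new-high-0or1 : ∀ c → NewBox c → countHigh (T r c) ≡ 0 ⊎ countHigh (T r c) ≡ 1
    new-high-0or1 c (inj₁ box≡) = inj₂ (trans (cong countHigh box≡) (countHigh-> [] (B<next-high c)))
    new-high-0or1 c (inj₂ ((_ , _ , j+1≤B) , inj₁ box≡)) = inj₁ (trans (cong countHigh box≡) (countHigh-≤ [] j+1≤B))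
    new-high-0or1 c (inj₂ ((_ , _ , j+1≤B) , inj₂ box≡)) =
      inj₂ (trans (cong countHigh box≡) (trans (countHigh-≤ _ j+1≤B) (countHigh-> [] (B<next-high c))))

    high-spreads-right : ∀ c c' → c₀ < c → c < c' → c' ≤ c₀ + w → NewBox c → countHigh (T r c) ≡ 1 → All (B <_) (T r c')
    high-spreads-right c c' c₀<c c<c' c'≤end (inj₁ box≡) _
      with subst (All (λ x → All (x ≤_) (T r c'))) box≡ (row-≤ˢ r c c' r₀<r r≤end c₀<c c<c' c'≤end)
    ... | top≤ ∷ [] = All-map (<-≤-trans (B<next-high c)) top≤
    high-spreads-right c c' c₀<c c<c' c'≤end (inj₂ ((_ , _ , j+1≤B) , inj₁ box≡)) one =
      ⊥-elim (0≢1+n (trans (sym (trans (cong countHigh box≡) (countHigh-≤ [] j+1≤B))) one))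
    high-spreads-right c c' c₀<c c<c' c'≤end (inj₂ (_ , inj₂ box≡)) _
      with subst (All (λ x → All (x ≤_) (T r c'))) box≡ (row-≤ˢ r c c' r₀<r r≤end c₀<c c<c' c'≤end)
    ... | _ ∷ top≤ ∷ [] = All-map (<-≤-trans (B<next-high c)) top≤

    all-high⇒one-high : ∀ c → NewBox c → All (B <_) (T r c) → countHigh (T r c) ≡ 1
    all-high⇒one-high c (inj₁ box≡) _ = trans (cong countHigh box≡) (countHigh-> [] (B<next-high c))
    all-high⇒one-high c (inj₂ ((_ , _ , j+1≤B) , inj₁ box≡)) allHigh with subst (All (B <_)) box≡ allHigh
    ... | B<j+1 ∷ [] = ⊥-elim (<⇒≱ B<j+1 j+1≤B)
    all-high⇒one-high c (inj₂ ((_ , _ , j+1≤B) , inj₂ box≡)) _ =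
      trans (cong countHigh box≡) (trans (countHigh-≤ _ j+1≤B) (countHigh-> [] (B<next-high c)))

    U-mono-next : ∀ c c' → c₀ < c → c' ≤ c₀ + w → c ≤ c' → U (suc j) c ≤ U (suc j) c'
    U-mono-next c c' c₀<c c'≤end c≤c' = subst₂ _≤_ (sym (U-suc c)) (sym (U-suc c')) grows
      where
      grows : U j c + countHigh (T r c) ≤ U j c' + countHigh (T r c')
      grows with m≤n⇒m<n∨m≡n c≤c'
      ... | inj₂ refl = ≤-refl
      ... | inj₁ c<c' with new-high-0or1 c (newBox c c₀<c (≤-trans c≤c' c'≤end))
      ...   | inj₁ none = ≤-trans (≤-reflexive (trans (cong (U j c +_) none) (+-identityʳ _)))
                            (≤-trans (U-mono c c' c₀<c c'≤end c≤c') (m≤m+n _ _))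
      ...   | inj₂ one = +-mono-≤ (U-mono c c' c₀<c c'≤end c≤c')
                           (≤-reflexive (trans one (sym (all-high⇒one-high c' (newBox c' (<-trans c₀<c c<c') c'≤end)
                             (high-spreads-right c c' c₀<c c<c' c'≤end (newBox c c₀<c (≤-trans c≤c' c'≤end)) one)))))

    rowsInv-next : RowsInv (suc j)
    rowsInv-next = newColumn , U-mono-next

  rowsInv : ∀ j → j ≤ h → RowsInv j
  rowsInv zero _ = rowsInv-0
  rowsInv (suc j) j<h = NextRow.rowsInv-next j j<h (rowsInv j (≤-trans (n≤1+n j) j<h))

lattice-prefixes : ∀ w → ReverseLattice w → ∀ u v → w ≡ u ++ v → ∀ i → occ (suc (suc i)) u ≤ occ (suc i) u
lattice-prefixes w lat u v w≡ i = subst (λ w′ → occ (suc (suc i)) w′ ≤ occ (suc i) w′)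
  (trans (cong (take (length u)) w≡) (take-prefix u v)) (lat (length u) i)

module TwoRectangles {l1 β m1 α : ℕ} {T : Filling}
  (ss : SemistandardSV l1 β m1 α T) (lat : ReverseLattice (word l1 β m1 α T)) where
  open SemistandardSV ss

  λword μword : List ℕ
  λword = concat (map (λ r → rowWord T r (ints (suc m1) l1)) (ints 1 β))
  μword = concat (map (λ r → rowWord T r (ints 1 m1)) (ints (suc β) α))

  module Lam = RectangleBlock T 0 0 0 m1 β l1 [] μword
    (λ r c r₀<r r≤ c₀<c c≤ → boxes r c (inLam (r₀<r , r≤ , c₀<c , c≤)))
    (λ r c r₀<r r≤ c₀<c c<end → rows r c (inLam (r₀<r , r≤ , c₀<c , ≤-trans (n≤1+n c) c<end))
                                          (inLam (r₀<r , r≤ , ≤-trans c₀<c (n≤1+n c) , c<end)))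
    (λ r c r₀<r r<end c₀<c c≤ → cols r c (inLam (r₀<r , ≤-trans (n≤1+n r) r<end , c₀<c , c≤))
                                          (inLam (s≤s z≤n , r<end , c₀<c , c≤)))
    (λ x 1≤x x≤0 → ⊥-elim (<⇒≱ 1≤x x≤0))
    (λ x _ → refl)
    (lattice-prefixes (word l1 β m1 α T) lat)

  λ-column : ∀ c → m1 < c → c ≤ m1 + l1 → Lam.column β c ≡ ints 1 β
  λ-column c m1<c c≤ = trans (Lam.ColumnShape.shape ci) (cong₂ (λ p u → ints 1 p ++ ints 1 u) P≡0 U≡β)
    where
    ci : Lam.ColumnInv β c
    ci = proj₁ (Lam.rowsInv β ≤-refl) c m1<c c≤
    P≡0 : Lam.P β c ≡ 0
    P≡0 = n≤0⇒n≡0 (Lam.ColumnShape.p≤B ci)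
    U≡β : Lam.U β c ≡ β
    U≡β = ≤-antisym (Lam.ColumnShape.u≤j ci) (≤-trans (Lam.ColumnShape.j≤p+u ci) (≤-reflexive (cong (_+ Lam.U β c) P≡0)))

  λword-low : ∀ x → 1 ≤ x → x ≤ β → occ x λword ≡ l1
  λword-low x 1≤x x≤β = trans (Lam.occ-blockW x β) (sumOver-ints-one (suc m1) l1 _ (λ c m1<c c< →
    trans (cong (occ x) (λ-column c m1<c (≤-pred c<))) (occ-ints-inside x 1 β 1≤x (s≤s x≤β))))

  λword-high : ∀ x → β < x → occ x λword ≡ 0
  λword-high x β<x = trans (Lam.occ-blockW x β) (sumOver-ints-zero (suc m1) l1 _ (λ c m1<c c< →
    trans (cong (occ x) (λ-column c m1<c (≤-pred c<))) (occ-ints-outside x 1 β (inj₂ β<x))))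

  module Mu = RectangleBlock T β l1 β 0 α m1 λword []
    (λ r c r₀<r r≤ c₀<c c≤ → boxes r c (inMu (r₀<r , r≤ , c₀<c , c≤)))
    (λ r c r₀<r r≤ c₀<c c<end → rows r c (inMu (r₀<r , r≤ , c₀<c , ≤-trans (n≤1+n c) c<end))
                                         (inMu (r₀<r , r≤ , ≤-trans c₀<c (n≤1+n c) , c<end)))
    (λ r c r₀<r r<end c₀<c c≤ → cols r c (inMu (r₀<r , ≤-trans (n≤1+n r) r<end , c₀<c , c≤))
                                         (inMu (≤-trans r₀<r (n≤1+n r) , r<end , c₀<c , c≤)))
    λword-low λword-high
    (λ u v ≡u++v → lattice-prefixes (word l1 β m1 α T) lat u v
                     (trans (cong (λword ++_) (sym (++-identityʳ μword))) ≡u++v))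

  μ-column : ∀ c → 1 ≤ c → c ≤ m1 → Mu.ColumnInv α c
  μ-column = proj₁ (Mu.rowsInv α ≤-refl)

lemma1 : (n k l1 β m1 α : ℕ) (T : Filling) →
    k ≤ n → RectFits n k l1 β → RectFits n k m1 α →
    Buch n k l1 β m1 α T →
    ∀ c → 1 ≤ c → c ≤ m1 →
    ∃₂ λ p q → (p ≤ α) × (β ≤ q) × (q ≤ β + α) ×
    (muColumn β α T c ≡ ints 1 p ++ ints (suc β) (q ∸ β)) ×
    (∀ r r' → β < r → r ≤ β + α → β < r' → r' ≤ β + α →
    2 ≤ length (T r c) → 2 ≤ length (T r' c) → r ≡ r') ×
    (∀ r → β < r → r ≤ β + α → 2 ≤ length (T r c) →
    T r c ≡ p ∷ suc β ∷ [])
lemma1 n k l1 β m1 α T _ _ _ buch c 1≤c c≤m1 =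
  p , β + u , p≤j , m≤m+n β u , +-monoʳ-≤ β u≤j ,
  trans shape (cong (λ m → ints 1 p ++ ints (suc β) m) (sym (m+n∸m≡n β u))) ,
  (λ r r' β<r r≤ β<r' r'≤ two two' → proj₂ (proj₂ (double r β<r r≤ two)) r' β<r' r'≤ two') ,
  (λ r β<r r≤ two → proj₁ (double r β<r r≤ two))
  where
  open TwoRectangles (Buch.semistandard buch) (Buch.lattice buch)
  open Mu.ColumnShape (μ-column c 1≤c c≤m1)
  p u : ℕ
  p = Mu.P α c
  u = Mu.U α c
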